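{- Let $\Gamma \subset \Gamma(2)$ be a congruence subgroup of level $2n$, i.e. $2n$ is the smallest positive integer $m$ with $\Gamma(m) \subset \Gamma$. Let $\mathcal G$ be the graph associated to $\Gamma$. Let $F$ be any face of $\mathcal G$, of degree $d$, and let $v$ be any vertex (black or white) of $\mathcal G$ lying on the boundary of $F$, of degree $e$. Then $2de \equiv 0 \pmod{n}$.
   Context: All groups are taken in $PSL_2(\mathbb{Z}) = SL_2(\mathbb{Z})/\{\pm I\}$, acting on the upper half-plane $\mathbb{H}$ by linear fractional transformations. $\Gamma(m)=\{\gamma \in PSL_2(\mathbb{Z}) : \gamma \equiv \pm I \pmod m\}$. A subgroup is congruence if it contains some $\Gamma(m)$. $\Gamma(2)$ is freely generated by $A=\begin{pmatrix}1&2\\0&1\end{pmatrix}$ and $B=\begin{pmatrix}1&0\\2&1\end{pmatrix}$. Graph associated to a finite-index subgroup $\Gamma\subset\Gamma(2)$: the surface $\Gamma\backslash\mathbb{H}$ is compactified by adding its cusps. Cusps that are $\Gamma(2)$-equivalent to $0$ become black vertices, cusps $\Gamma(2)$-equivalent to $1$ become white vertices, and cusps $\Gamma(2)$-equivalent to $\infty$ become face centers. The edges are the images of the hyperbolic geodesic from $0$ to $1$. This gives a connected bipartite graph embedded in a compact orientable surface whose complementary regions (faces) are open 2-cells, one containing each face center. The degree of a vertex is the number of edges incident to it. The degree of a face is the number of edges it contains, where each edge is counted as contained in the face lying to its left when viewed from its black endpoint; equivalently, each face is bounded by $2d$ edge-sides if it has degree $d$. A vertex or face of degree $d$ corresponds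 to a cusp of $\Gamma$ of width $2d$. -}

module Defs where

open import Data.Nat using (ℕ; zero; suc; _<_)
open import Data.Integer as ℤ using (ℤ; +_; -_) renaming (_+_ to _+ℤ_; _-_ to _-ℤ_; _*_ to _*ℤ_)
open import Data.Integer.Divisibility using () renaming (_∣_ to _∣ℤ_)
open import Data.Fin using (Fin)
open import Data.Fin.Permutation using (Permutation′; _⟨$⟩ʳ_; _⟨$⟩ˡ_)
open import Data.List using (List; []; _∷_)
open import Data.Product using (Σ; ∃; _×_; _,_)
open import Data.Sum using (_⊎_)
open import Relation.Binary.PropositionalEquality using (_≡_; _≢_)
open import Relation.Nullary using (¬_)

-- 2x2 integer matrices, SL₂(ℤ); PSL₂(ℤ) is handled by identifying ±γ.

record M2 : Set where
  constructor mat
  field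
    a b c d : ℤ
open M2 public

_·_ : M2 → M2 → M2
mat a b c d · mat a′ b′ c′ d′ =
  mat (a *ℤ a′ +ℤ b *ℤ c′) (a *ℤ b′ +ℤ b *ℤ d′)
      (c *ℤ a′ +ℤ d *ℤ c′) (c *ℤ b′ +ℤ d *ℤ d′)

I₂ : M2
I₂ = mat (+ 1) (+ 0) (+ 0) (+ 1)

neg : M2 → M2
neg (mat a b c d) = mat (- a) (- b) (- c) (- d)

det : M2 → ℤ
det (mat a b c d) = a *ℤ d -ℤ b *ℤ c

IsSL2 : M2 → Set
IsSL2 γ = det γ ≡ + 1

_≈±_ : M2 → M2 → Set
γ ≈± δ = (γ ≡ δ) ⊎ (γ ≡ neg δ)

InΓ[_] : ℕ → M2 → Set
InΓ[ m ] (mat a b c d) =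
  ((+ m ∣ℤ (a -ℤ + 1)) × (+ m ∣ℤ b) × (+ m ∣ℤ c) × (+ m ∣ℤ (d -ℤ + 1)))
  ⊎ ((+ m ∣ℤ (a +ℤ + 1)) × (+ m ∣ℤ b) × (+ m ∣ℤ c) × (+ m ∣ℤ (d +ℤ + 1)))

-- Words in the free generators A, B of Γ(2)

data Letter : Set where
  A A⁻¹ B B⁻¹ : Letter

letterMat : Letter → M2
letterMat A   = mat (+ 1) (+ 2) (+ 0) (+ 1)
letterMat A⁻¹ = mat (+ 1) (- + 2) (+ 0) (+ 1)
letterMat B   = mat (+ 1) (+ 0) (+ 2) (+ 1)
letterMat B⁻¹ = mat (+ 1) (+ 0) (- + 2) (+ 1)

Word : Set
Word = List Letter

wordMat : Word → M2
wordMat []      = I₂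
wordMat (x ∷ w) = letterMat x · wordMat w

-- A finite-index subgroup Γ ⊆ Γ(2) is given by the (right) action of
-- Γ(2) = ⟨A , B⟩ on the coset space Γ\Γ(2) = Fin (suc N), with base
-- point (the coset Γ itself) zero.

record CosetAction : Set where
  field
    N  : ℕ
    pA : Permutation′ (suc N)
    pB : Permutation′ (suc N)
open CosetAction public

Pt : CosetAction → Set
Pt Γ = Fin (suc (N Γ))

actLetter : (Γ : CosetAction) → Letter → Pt Γ → Pt Γ
actLetter Γ A   x = pA Γ ⟨$⟩ʳ x
actLetter Γ A⁻¹ x = pA Γ ⟨$⟩ˡ x
actLetter Γ B   x = pB Γ ⟨$⟩ʳ x
actLetter Γ B⁻¹ x = pB Γ ⟨$⟩ˡ x

act : (Γ : CosetAction) → Word → Pt Γ → Pt Γ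
act Γ []      x = x
act Γ (l ∷ w) x = act Γ w (actLetter Γ l x)

base : (Γ : CosetAction) → Pt Γ
base Γ = Fin.zero

-- the action is transitive (so Fin (suc N) really is Γ\Γ(2))
Transitive : CosetAction → Set
Transitive Γ = ∀ (x y : Pt Γ) → ∃ λ w → act Γ w x ≡ y

_∈Γ_ : M2 → CosetAction → Set
γ ∈Γ Γ = ∃ λ w → (wordMat w ≈± γ) × (act Γ w (base Γ) ≡ base Γ)

Γ[_]⊆_ : ℕ → CosetAction → Set
Γ[ m ]⊆ Γ = ∀ (γ : M2) → IsSL2 γ → InΓ[ m ] γ → γ ∈Γ Γ

HasLevel : CosetAction → ℕ → Set
HasLevel Γ m = 0 < m × Γ[ m ]⊆ Γ × (∀ k → 0 < k → k < m → ¬ (Γ[ k ]⊆ Γ))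

-- Edges = cosets x ∈ Γ\Γ(2) (edge x is the
-- image of g·(geodesic 0→1) for x = Γg). Black vertices = cycles of the
-- action of B (stabiliser of 0), white vertices = cycles of A·B⁻¹
-- (stabiliser of 1), faces = cycles of A (stabiliser of ∞). Edge x lies
-- in the face of x (the face on its left seen from its black endpoint).

Perm : CosetAction → Set
Perm Γ = Pt Γ → Pt Γ

σA σB σW : (Γ : CosetAction) → Perm Γ
σA Γ x = act Γ (A ∷ []) x
σB Γ x = act Γ (B ∷ []) x
σW Γ x = act Γ (A ∷ B⁻¹ ∷ []) x

iter : {X : Set} → (X → X) → ℕ → X → X
iter f zero    x = x
iter f (suc k) x = f (iter f k x)

InCycle : {X : Set} → (X → X) → X → X → Set
InCycle σ y x = ∃ λ k → iter σ k y ≡ x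

-- the cycle of σ through y has length k (= number of edges of that
-- vertex/face, i.e. its degree)
CycleLength : {X : Set} → (X → X) → X → ℕ → Set
CycleLength σ y k =
  0 < k × iter σ k y ≡ y × (∀ j → 0 < j → j < k → iter σ j y ≢ y)

data Colour : Set where
  black white : Colour

vertexPerm : (Γ : CosetAction) → Colour → Perm Γ
vertexPerm Γ black = σB Γ
vertexPerm Γ white = σW Γ

{-# OPTIONS --safe #-}
-- Let x be an edge of F at v and N = 2n. The stabiliser Γₓ of the coset x is conjugate to Γ,
-- so it contains the normal subgroup Γ(N). Going d times around F gives A^d = up(2d) ∈ Γₓ;
-- going e times around v gives ±P⁻¹ lo(2e) P ∈ Γₓ, where P = up(0) or up(-1) moves the cusp
-- of v to 0. So H = P Γₓ P⁻¹ contains up(2d), lo(2e) and Γ(N), and any such H contains Γ(K)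
-- for K = gcd(N, 4de) = αN + β·4de: a given γ ∈ Γ(K) is first shifted to η = up(Kr) γ whose
-- corner entry a is a unit mod N, with inverse u; as a ≡ 1 + 2e·x mod N with 2d ∣ x, η is
-- congruent mod N to lo(c u) · lo(-2e u) up(x) lo(2e) up(-x u) · up(u b), a product of
-- elements of H. Hence Γ(K) ⊆ Γ, and minimality of the level forces K = N, i.e. 2n ∣ 4de.
module Submission where

open import Defs

module Matrices where
  open import Data.Integer as ℤ using (ℤ; +_; -_; _+_; _*_; _-_)
  import Data.Integer.Properties as ℤ
  open import Data.Integer.Tactic.RingSolver using (solve-∀)
  open import Relation.Binary.PropositionalEquality

  mat-cong : ∀ {a b c d a′ b′ c′ d′} → a ≡ a′ → b ≡ b′ → c ≡ c′ → d ≡ d′ →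
             mat a b c d ≡ mat a′ b′ c′ d′
  mat-cong refl refl refl refl = refl

  adj : M2 → M2
  adj (mat a b c d) = mat d (- b) (- c) a

  up lo : ℤ → M2
  up t = mat (+ 1) t (+ 0) (+ 1)
  lo t = mat (+ 1) (+ 0) t (+ 1)

  diag : ℤ → ℤ → M2
  diag x y = mat x (+ 0) (+ 0) y

  conj : M2 → M2 → M2
  conj P γ = (adj P · γ) · P

  ·-assoc : ∀ X Y Z → (X · Y) · Z ≡ X · (Y · Z)
  ·-assoc (mat a b c d) (mat e f g h) (mat i j k l) =
    mat-cong (entry a b e f g h i k) (entry a b e f g h j l) (entry c d e f g h i k) (entry c d e f g h j l)
    where
    entry : ∀ p q r s t u v w → (p * r + q * t) * v + (p * s + q * u) * w ≡ p * (r * v + s * w) + q * (t * v + u * w)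
    entry = solve-∀

  private
    unitˡ : ∀ x y → + 1 * x + + 0 * y ≡ x
    unitˡ = solve-∀
    unitˡ′ : ∀ x y → + 0 * x + + 1 * y ≡ y
    unitˡ′ = solve-∀
    unitʳ : ∀ x y → x * + 1 + y * + 0 ≡ x
    unitʳ = solve-∀
    unitʳ′ : ∀ x y → x * + 0 + y * + 1 ≡ y
    unitʳ′ = solve-∀

  ·-identityˡ : ∀ X → I₂ · X ≡ X
  ·-identityˡ (mat a b c d) = mat-cong (unitˡ a c) (unitˡ b d) (unitˡ′ a c) (unitˡ′ b d)

  ·-identityʳ : ∀ X → X · I₂ ≡ X
  ·-identityʳ (mat a b c d) = mat-cong (unitʳ a b) (unitʳ′ a b) (unitʳ c d) (unitʳ′ c d)

  lo-· : ∀ t X → lo t · X ≡ mat (a X) (b X) (c X + t * a X) (d X + t * b X)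
  lo-· t (mat a b c d) = mat-cong (unitˡ a c) (unitˡ b d) (shear t a c) (shear t b d)
    where
    shear : ∀ t x y → t * x + + 1 * y ≡ y + t * x
    shear = solve-∀

  ·-up : ∀ X t → X · up t ≡ mat (a X) (b X + a X * t) (c X) (d X + c X * t)
  ·-up (mat a b c d) t = mat-cong (unitʳ a b) (shear t a b) (unitʳ c d) (shear t c d)
    where
    shear : ∀ t x y → x * t + y * + 1 ≡ y + x * t
    shear = solve-∀

  up-·-lo : ∀ x v → up x · lo v ≡ mat (+ 1 + x * v) x v (+ 1)
  up-·-lo x v = mat-cong (corner x v) (unitʳ′ (+ 1) x) (unitˡ′ (+ 0) v) refl
    where
    corner : ∀ x v → + 1 * + 1 + x * v ≡ + 1 + x * v
    corner = solve-∀

  neg-distribˡ-· : ∀ X Y → neg X · Y ≡ neg (X · Y)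
  neg-distribˡ-· (mat a b c d) (mat e f g h) = mat-cong (entry a b e g) (entry a b f h) (entry c d e g) (entry c d f h)
    where
    entry : ∀ p q r s → (- p) * r + (- q) * s ≡ - (p * r + q * s)
    entry = solve-∀

  neg-distribʳ-· : ∀ X Y → X · neg Y ≡ neg (X · Y)
  neg-distribʳ-· (mat a b c d) (mat e f g h) = mat-cong (entry a b e g) (entry a b f h) (entry c d e g) (entry c d f h)
    where
    entry : ∀ p q r s → p * (- r) + q * (- s) ≡ - (p * r + q * s)
    entry = solve-∀

  neg-involutive : ∀ X → neg (neg X) ≡ X
  neg-involutive (mat a b c d) =
    mat-cong (ℤ.neg-involutive a) (ℤ.neg-involutive b) (ℤ.neg-involutive c) (ℤ.neg-involutive d)

  det-· : ∀ X Y → det (X · Y) ≡ det X * det Y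
  det-· (mat a b c d) (mat e f g h) = binet a b c d e f g h
    where
    binet : ∀ a b c d e f g h →
            (a * e + b * g) * (c * f + d * h) - (a * f + b * h) * (c * e + d * g) ≡ (a * d - b * c) * (e * h - f * g)
    binet = solve-∀

  det-adj : ∀ X → det (adj X) ≡ det X
  det-adj (mat a b c d) = entry a b c d
    where
    entry : ∀ a b c d → d * a - (- b) * (- c) ≡ a * d - b * c
    entry = solve-∀

  det-neg : ∀ X → det (neg X) ≡ det X
  det-neg (mat a b c d) = entry a b c d
    where
    entry : ∀ a b c d → (- a) * (- d) - (- b) * (- c) ≡ a * d - b * c
    entry = solve-∀

  adj-anti-· : ∀ X Y → adj (X · Y) ≡ adj Y · adj X
  adj-anti-· (mat a b c d) (mat e f g h) = mat-cong (d₁ c f d h) (o₁ a f b h) (o₂ c e d g) (d₂ a e b g)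
    where
    d₁ : ∀ p q r s → p * q + r * s ≡ s * r + (- q) * (- p)
    d₁ = solve-∀
    d₂ : ∀ p q r s → p * q + r * s ≡ (- s) * (- r) + q * p
    d₂ = solve-∀
    o₁ : ∀ p q r s → - (p * q + r * s) ≡ s * (- r) + (- q) * p
    o₁ = solve-∀
    o₂ : ∀ p q r s → - (p * q + r * s) ≡ (- s) * r + q * (- p)
    o₂ = solve-∀

  adj-involutive : ∀ X → adj (adj X) ≡ X
  adj-involutive (mat a b c d) = mat-cong refl (ℤ.neg-involutive b) (ℤ.neg-involutive c) refl

  adj-neg : ∀ X → adj (neg X) ≡ neg (adj X)
  adj-neg (mat a b c d) = refl

  adj-inverseʳ : ∀ X → IsSL2 X → X · adj X ≡ I₂
  adj-inverseʳ (mat a b c d) det≡1 = begin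
    mat (a * d + b * (- c)) (a * (- b) + b * a) (c * d + d * (- c)) (c * (- b) + d * a)
      ≡⟨ mat-cong (diagonal a b c d) (off₁ a b) (off₂ c d) (diagonal′ a b c d) ⟩
    diag (a * d - b * c) (a * d - b * c)
      ≡⟨ cong (λ t → diag t t) det≡1 ⟩
    I₂ ∎
    where
    open ≡-Reasoning
    diagonal : ∀ a b c d → a * d + b * (- c) ≡ a * d - b * c
    diagonal = solve-∀
    diagonal′ : ∀ a b c d → c * (- b) + d * a ≡ a * d - b * c
    diagonal′ = solve-∀
    off₁ : ∀ a b → a * (- b) + b * a ≡ + 0
    off₁ = solve-∀
    off₂ : ∀ c d → c * d + d * (- c) ≡ + 0
    off₂ = solve-∀

  IsSL2-· : ∀ X Y → IsSL2 X → IsSL2 Y → IsSL2 (X · Y)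
  IsSL2-· X Y detX detY = trans (det-· X Y) (cong₂ _*_ detX detY)

  IsSL2-adj : ∀ X → IsSL2 X → IsSL2 (adj X)
  IsSL2-adj X = trans (det-adj X)

  IsSL2-neg : ∀ X → IsSL2 X → IsSL2 (neg X)
  IsSL2-neg X = trans (det-neg X)

  IsSL2-conj : ∀ P X → IsSL2 P → IsSL2 X → IsSL2 (conj P X)
  IsSL2-conj P X detP detX = IsSL2-· (adj P · X) P (IsSL2-· (adj P) X (IsSL2-adj P detP) detX) detP

  adj-inverseˡ : ∀ X → IsSL2 X → adj X · X ≡ I₂
  adj-inverseˡ X detX =
    subst (λ Y → adj X · Y ≡ I₂) (adj-involutive X) (adj-inverseʳ (adj X) (IsSL2-adj X detX))

  conj-· : ∀ P X Y → IsSL2 P → conj P X · conj P Y ≡ conj P (X · Y)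
  conj-· P X Y detP = begin
    ((adj P · X) · P) · ((adj P · Y) · P)   ≡⟨ ·-assoc (adj P · X) P _ ⟩
    (adj P · X) · (P · ((adj P · Y) · P))   ≡⟨ cong ((adj P · X) ·_) (sym (·-assoc P (adj P · Y) P)) ⟩
    (adj P · X) · ((P · (adj P · Y)) · P)   ≡⟨ cong (λ Z → (adj P · X) · (Z · P)) (sym (·-assoc P (adj P) Y)) ⟩
    (adj P · X) · (((P · adj P) · Y) · P)   ≡⟨ cong (λ Z → (adj P · X) · ((Z · Y) · P)) (adj-inverseʳ P detP) ⟩
    (adj P · X) · ((I₂ · Y) · P)            ≡⟨ cong (λ Z → (adj P · X) · (Z · P)) (·-identityˡ Y) ⟩
    (adj P · X) · (Y · P)                   ≡⟨ ·-assoc (adj P) X (Y · P) ⟩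
    adj P · (X · (Y · P))                   ≡⟨ cong (adj P ·_) (sym (·-assoc X Y P)) ⟩
    adj P · ((X · Y) · P)                   ≡⟨ sym (·-assoc (adj P) (X · Y) P) ⟩
    (adj P · (X · Y)) · P                   ∎
    where open ≡-Reasoning

  conj-adj : ∀ P X → adj (conj P X) ≡ conj P (adj X)
  conj-adj P X = begin
    adj ((adj P · X) · P)         ≡⟨ adj-anti-· (adj P · X) P ⟩
    adj P · adj (adj P · X)       ≡⟨ cong (adj P ·_) (adj-anti-· (adj P) X) ⟩
    adj P · (adj X · adj (adj P)) ≡⟨ cong (λ Q → adj P · (adj X · Q)) (adj-involutive P) ⟩
    adj P · (adj X · P)           ≡⟨ sym (·-assoc (adj P) (adj X) P) ⟩
    (adj P · adj X) · P           ∎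
    where open ≡-Reasoning

  conj-neg : ∀ P X → neg (conj P X) ≡ conj P (neg X)
  conj-neg P X = trans (sym (neg-distribˡ-· (adj P · X) P)) (cong (_· P) (sym (neg-distribʳ-· (adj P) X)))

  conj-I₂ : ∀ P → IsSL2 P → conj P I₂ ≡ I₂
  conj-I₂ P detP = trans (cong (_· P) (·-identityʳ (adj P))) (adj-inverseˡ P detP)

  conj-adj-cancel : ∀ P X → IsSL2 P → conj P (conj (adj P) X) ≡ X
  conj-adj-cancel P X detP = begin
    (adj P · ((adj (adj P) · X) · adj P)) · P   ≡⟨ cong (λ Q → (adj P · ((Q · X) · adj P)) · P) (adj-involutive P) ⟩
    (adj P · ((P · X) · adj P)) · P             ≡⟨ ·-assoc (adj P) _ P ⟩
    adj P · (((P · X) · adj P) · P)             ≡⟨ cong (adj P ·_) (·-assoc (P · X) (adj P) P) ⟩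
    adj P · ((P · X) · (adj P · P))             ≡⟨ cong (λ Q → adj P · ((P · X) · Q)) (adj-inverseˡ P detP) ⟩
    adj P · ((P · X) · I₂)                      ≡⟨ cong (adj P ·_) (·-identityʳ (P · X)) ⟩
    adj P · (P · X)                             ≡⟨ sym (·-assoc (adj P) P X) ⟩
    (adj P · P) · X                             ≡⟨ cong (_· X) (adj-inverseˡ P detP) ⟩
    I₂ · X                                      ≡⟨ ·-identityˡ X ⟩
    X                                           ∎
    where open ≡-Reasoning

  conj-cancel : ∀ P X → IsSL2 P → conj (adj P) (conj P X) ≡ X
  conj-cancel P X detP = subst (λ Q → conj (adj P) (conj Q X) ≡ X) (adj-involutive P)
                           (conj-adj-cancel (adj P) X (IsSL2-adj P detP))

  record OneParameter (f : ℤ → M2) : Set where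
    field
      homomorphic : ∀ s t → f s · f t ≡ f (s + t)
      at-zero : f (+ 0) ≡ I₂
      adj-f : ∀ t → adj (f t) ≡ f (- t)
      SL2-f : ∀ t → IsSL2 (f t)

  up-oneParameter : OneParameter up
  up-oneParameter = record
    { homomorphic = λ s t → mat-cong (unitʳ (+ 1) s) (entry s t) refl refl
    ; at-zero = refl
    ; adj-f = λ t → refl
    ; SL2-f = λ t → cong (λ z → + 1 - z) (ℤ.*-zeroʳ t)
    }
    where
    entry : ∀ s t → + 1 * t + s * + 1 ≡ s + t
    entry = solve-∀

  lo-oneParameter : OneParameter lo
  lo-oneParameter = record
    { homomorphic = λ s t → mat-cong refl refl (entry s t) (unitʳ′ s (+ 1))
    ; at-zero = refl
    ; adj-f = λ t → refl
    ; SL2-f = λ t → refl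
    }
    where
    entry : ∀ s t → s * + 1 + + 1 * t ≡ s + t
    entry = solve-∀

  conj-oneParameter : ∀ P {f} → IsSL2 P → OneParameter f → OneParameter (λ t → conj P (f t))
  conj-oneParameter P {f} detP F = record
    { homomorphic = λ s t → trans (conj-· P (f s) (f t) detP) (cong (conj P) (homomorphic s t))
    ; at-zero = trans (cong (conj P) at-zero) (conj-I₂ P detP)
    ; adj-f = λ t → trans (conj-adj P (f t)) (cong (conj P) (adj-f t))
    ; SL2-f = λ t → IsSL2-conj P (f t) detP (SL2-f t)
    }
    where open OneParameter F

  conj-up-up : ∀ s t → conj (up s) (up t) ≡ up t
  conj-up-up s t = begin
    (up (- s) · up t) · up s  ≡⟨ cong (_· up s) (homomorphic (- s) t) ⟩
    up (- s + t) · up s       ≡⟨ homomorphic (- s + t) s ⟩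
    up (- s + t + s)          ≡⟨ cong up (cancel s t) ⟩
    up t                      ∎
    where
    open ≡-Reasoning
    open OneParameter up-oneParameter
    cancel : ∀ s t → - s + t + s ≡ t
    cancel = solve-∀

  up-cancel : ∀ t X → up (- t) · (up t · X) ≡ X
  up-cancel t X = begin
    up (- t) · (up t · X)   ≡⟨ sym (·-assoc (up (- t)) (up t) X) ⟩
    (up (- t) · up t) · X   ≡⟨ cong (_· X) (homomorphic (- t) t) ⟩
    up (- t + t) · X        ≡⟨ cong (λ s → up s · X) (ℤ.+-inverseˡ t) ⟩
    I₂ · X                  ≡⟨ ·-identityˡ X ⟩
    X                       ∎
    where
    open ≡-Reasoning
    open OneParameter up-oneParameter

open Matrices

module Congruences where
  open import Data.Integer as ℤ using (ℤ; +_; -_; _+_; _*_; _-_)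
  import Data.Integer.Properties as ℤ
  open import Data.Integer.Divisibility using () renaming (_∣_ to _∣ᵤ_)
  open import Data.Integer.Divisibility.Signed as ℤ∣
    using (_∣_; divides; ∣m∣n⇒∣m+n; ∣m⇒∣-m; ∣n⇒∣m*n; ∣m⇒∣m*n; ∣ᵤ⇒∣; ∣⇒∣ᵤ)
  open import Data.Integer.Tactic.RingSolver using (solve)
  open import Data.List using ([]; _∷_)
  open import Data.Nat as ℕ using (ℕ)
  open import Data.Product using (_,_)
  open import Data.Sum using (_⊎_; inj₁; inj₂)
  open import Relation.Binary.PropositionalEquality

  infix 4 _≈_mod_ _≋_mod_

  record _≈_mod_ (x y m : ℤ) : Set where
    constructor ∣-difference
    field
      divides-difference : m ∣ x - y

  ≈mod-by : ∀ {m e x y} → m ∣ e → e ≡ x - y → x ≈ y mod m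
  ≈mod-by m∣e refl = ∣-difference m∣e

  ≈mod-refl : ∀ {m} x → x ≈ x mod m
  ≈mod-refl x = ≈mod-by (divides (+ 0) refl) (sym (ℤ.+-inverseʳ x))

  ≈mod-sym : ∀ {m x y} → x ≈ y mod m → y ≈ x mod m
  ≈mod-sym {x = x} {y} (∣-difference m∣x-y) = ≈mod-by (∣m⇒∣-m m∣x-y) (solve (x ∷ y ∷ []))

  ≈mod-trans : ∀ {m x y z} → x ≈ y mod m → y ≈ z mod m → x ≈ z mod m
  ≈mod-trans {x = x} {y} {z} (∣-difference m∣x-y) (∣-difference m∣y-z) =
    ≈mod-by (∣m∣n⇒∣m+n m∣x-y m∣y-z) (solve (x ∷ y ∷ z ∷ []))

  ≈mod-+ : ∀ {m x x′ y y′} → x ≈ x′ mod m → y ≈ y′ mod m → x + y ≈ x′ + y′ mod m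
  ≈mod-+ {x = x} {x′} {y} {y′} (∣-difference m∣x-x′) (∣-difference m∣y-y′) =
    ≈mod-by (∣m∣n⇒∣m+n m∣x-x′ m∣y-y′) (solve (x ∷ x′ ∷ y ∷ y′ ∷ []))

  ≈mod-* : ∀ {m x x′ y y′} → x ≈ x′ mod m → y ≈ y′ mod m → x * y ≈ x′ * y′ mod m
  ≈mod-* {x = x} {x′} {y} {y′} (∣-difference m∣x-x′) (∣-difference m∣y-y′) =
    ≈mod-by (∣m∣n⇒∣m+n (∣m⇒∣m*n y m∣x-x′) (∣n⇒∣m*n x′ m∣y-y′)) (solve (x ∷ x′ ∷ y ∷ y′ ∷ []))

  ≈mod-neg : ∀ {m x x′} → x ≈ x′ mod m → - x ≈ - x′ mod m
  ≈mod-neg {x = x} {x′} (∣-difference m∣x-x′) = ≈mod-by (∣m⇒∣-m m∣x-x′) (solve (x ∷ x′ ∷ []))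

  ≈0⇒∣ : ∀ {m x} → x ≈ + 0 mod m → m ∣ x
  ≈0⇒∣ {m} {x} (∣-difference m∣x-0) = subst (m ∣_) (ℤ.+-identityʳ x) m∣x-0

  x+y*t≈x : ∀ x y t → x + y * t ≈ x mod y
  x+y*t≈x x y t = ≈mod-by (∣m⇒∣m*n t ℤ∣.∣-refl) (solve (x ∷ y ∷ t ∷ []))

  y+x≈x : ∀ x y → y + x ≈ x mod y
  y+x≈x x y = ≈mod-by ℤ∣.∣-refl (solve (x ∷ y ∷ []))

  record _≋_mod_ (X Y : M2) (m : ℤ) : Set where
    constructor entrywise≡
    field
      on-a : a X ≈ a Y mod m
      on-b : b X ≈ b Y mod m
      on-c : c X ≈ c Y mod m
      on-d : d X ≈ d Y mod m

  ≋-refl : ∀ {m} X → X ≋ X mod m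
  ≋-refl X = entrywise≡ (≈mod-refl (a X)) (≈mod-refl (b X)) (≈mod-refl (c X)) (≈mod-refl (d X))

  ≋-reflexive : ∀ {m X Y} → X ≡ Y → X ≋ Y mod m
  ≋-reflexive {X = X} refl = ≋-refl X

  ≋-sym : ∀ {m X Y} → X ≋ Y mod m → Y ≋ X mod m
  ≋-sym (entrywise≡ ≈a ≈b ≈c ≈d) = entrywise≡ (≈mod-sym ≈a) (≈mod-sym ≈b) (≈mod-sym ≈c) (≈mod-sym ≈d)

  ≋-trans : ∀ {m X Y Z} → X ≋ Y mod m → Y ≋ Z mod m → X ≋ Z mod m
  ≋-trans (entrywise≡ ≈a ≈b ≈c ≈d) (entrywise≡ ≈a′ ≈b′ ≈c′ ≈d′) =
    entrywise≡ (≈mod-trans ≈a ≈a′) (≈mod-trans ≈b ≈b′) (≈mod-trans ≈c ≈c′) (≈mod-trans ≈d ≈d′)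

  ·-cong : ∀ {m X X′ Y Y′} → X ≋ X′ mod m → Y ≋ Y′ mod m → X · Y ≋ X′ · Y′ mod m
  ·-cong (entrywise≡ ≈a ≈b ≈c ≈d) (entrywise≡ ≈a′ ≈b′ ≈c′ ≈d′) = entrywise≡
    (≈mod-+ (≈mod-* ≈a ≈a′) (≈mod-* ≈b ≈c′)) (≈mod-+ (≈mod-* ≈a ≈b′) (≈mod-* ≈b ≈d′))
    (≈mod-+ (≈mod-* ≈c ≈a′) (≈mod-* ≈d ≈c′)) (≈mod-+ (≈mod-* ≈c ≈b′) (≈mod-* ≈d ≈d′))

  neg-cong : ∀ {m X Y} → X ≋ Y mod m → neg X ≋ neg Y mod m
  neg-cong (entrywise≡ ≈a ≈b ≈c ≈d) = entrywise≡ (≈mod-neg ≈a) (≈mod-neg ≈b) (≈mod-neg ≈c) (≈mod-neg ≈d)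

  conj-cong : ∀ {m X Y} P → X ≋ Y mod m → conj P X ≋ conj P Y mod m
  conj-cong P X≋Y = ·-cong (·-cong (≋-refl (adj P)) X≋Y) (≋-refl P)

  private
    ∣ᵤ⇒≈ : ∀ {m x y} → + m ∣ᵤ x - y → x ≈ y mod + m
    ∣ᵤ⇒≈ m∣x-y = ∣-difference (∣ᵤ⇒∣ m∣x-y)

    ∣ᵤ⇒≈0 : ∀ {m x} → + m ∣ᵤ x → x ≈ + 0 mod + m
    ∣ᵤ⇒≈0 {x = x} m∣x = ≈mod-by (∣ᵤ⇒∣ m∣x) (sym (ℤ.+-identityʳ x))

    ≈0⇒∣ᵤ : ∀ {m x} → x ≈ + 0 mod + m → + m ∣ᵤ x
    ≈0⇒∣ᵤ x≈0 = ∣⇒∣ᵤ (≈0⇒∣ x≈0)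

  fromInΓ : ∀ {m} γ → InΓ[ m ] γ → (γ ≋ I₂ mod + m) ⊎ (γ ≋ neg I₂ mod + m)
  fromInΓ (mat a b c d) (inj₁ (m∣a , m∣b , m∣c , m∣d)) =
    inj₁ (entrywise≡ (∣ᵤ⇒≈ m∣a) (∣ᵤ⇒≈0 m∣b) (∣ᵤ⇒≈0 m∣c) (∣ᵤ⇒≈ m∣d))
  fromInΓ (mat a b c d) (inj₂ (m∣a , m∣b , m∣c , m∣d)) =
    inj₂ (entrywise≡ (∣ᵤ⇒≈ m∣a) (∣ᵤ⇒≈0 m∣b) (∣ᵤ⇒≈0 m∣c) (∣ᵤ⇒≈ m∣d))

  toInΓ : ∀ {m} γ → (γ ≋ I₂ mod + m) ⊎ (γ ≋ neg I₂ mod + m) → InΓ[ m ] γ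
  toInΓ (mat a b c d) (inj₁ (entrywise≡ (∣-difference m∣a) m∣b m∣c (∣-difference m∣d))) =
    inj₁ (∣⇒∣ᵤ m∣a , ≈0⇒∣ᵤ m∣b , ≈0⇒∣ᵤ m∣c , ∣⇒∣ᵤ m∣d)
  toInΓ (mat a b c d) (inj₂ (entrywise≡ (∣-difference m∣a) m∣b m∣c (∣-difference m∣d))) =
    inj₂ (∣⇒∣ᵤ m∣a , ≈0⇒∣ᵤ m∣b , ≈0⇒∣ᵤ m∣c , ∣⇒∣ᵤ m∣d)

  InΓ-conj : ∀ {m} P γ → IsSL2 P → InΓ[ m ] γ → InΓ[ m ] (conj P γ)
  InΓ-conj P γ detP γ∈Γ[m] with fromInΓ γ γ∈Γ[m]
  ... | inj₁ γ≋I = toInΓ _ (inj₁ (≋-trans (conj-cong P γ≋I) (≋-reflexive (conj-I₂ P detP))))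
  ... | inj₂ γ≋-I = toInΓ _ (inj₂ (≋-trans (conj-cong P γ≋-I) (≋-reflexive conj-neg-I₂)))
    where
    conj-neg-I₂ : conj P (neg I₂) ≡ neg I₂
    conj-neg-I₂ = trans (sym (conj-neg P I₂)) (cong neg (conj-I₂ P detP))

  record IsSubgroup (H : M2 → Set) : Set where
    field
      ⊆SL2 : ∀ {X} → H X → IsSL2 X
      ·-closed : ∀ {X Y} → H X → H Y → H (X · Y)
      adj-closed : ∀ {X} → H X → H (adj X)
      neg-closed : ∀ {X} → H X → H (neg X)

  conjugate-isSubgroup : ∀ {H} P → IsSL2 P → IsSubgroup H → IsSubgroup (λ X → H (conj P X))
  conjugate-isSubgroup {H} P detP isSubgroup = record
    { ⊆SL2 = λ {X} HX → subst IsSL2 (conj-cancel P X detP)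
                             (IsSL2-conj (adj P) (conj P X) (IsSL2-adj P detP) (⊆SL2 HX))
    ; ·-closed = λ {X} {Y} HX HY → subst H (conj-· P X Y detP) (·-closed HX HY)
    ; adj-closed = λ {X} HX → subst H (conj-adj P X) (adj-closed HX)
    ; neg-closed = λ {X} HX → subst H (conj-neg P X) (neg-closed HX)
    }
    where open IsSubgroup isSubgroup

  ContainsΓ : ℕ → (M2 → Set) → Set
  ContainsΓ m H = ∀ γ → IsSL2 γ → InΓ[ m ] γ → H γ

  containsΓ-conj : ∀ {m H} P → IsSL2 P → ContainsΓ m H → ContainsΓ m (λ X → H (conj P X))
  containsΓ-conj P detP Γ[m]⊆H γ detγ γ∈Γ[m] =
    Γ[m]⊆H (conj P γ) (IsSL2-conj P γ detP detγ) (InΓ-conj P γ detP γ∈Γ[m])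

  containsΓ-unconj : ∀ {m H} P → IsSL2 P → ContainsΓ m (λ X → H (conj P X)) → ContainsΓ m H
  containsΓ-unconj {H = H} P detP Γ[m]⊆H^P γ detγ γ∈Γ[m] =
    subst H (conj-adj-cancel P γ detP)
      (containsΓ-conj (adj P) (IsSL2-adj P detP) Γ[m]⊆H^P γ detγ γ∈Γ[m])

  module SubgroupProperties {H : M2 → Set} (isSubgroup : IsSubgroup H) where
    open IsSubgroup isSubgroup

    ≋-closed : ∀ {N} → ContainsΓ N H → ∀ {γ δ} → IsSL2 δ → γ ≋ δ mod + N → H γ → H δ
    ≋-closed Γ[N]⊆H {γ} {δ} detδ γ≋δ Hγ = subst H γ·γ⁻¹δ≡δ (·-closed Hγ Hγ⁻¹δ)
      where
      detγ = ⊆SL2 Hγ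
      γ⁻¹δ≋I : adj γ · δ ≋ I₂ mod + _
      γ⁻¹δ≋I = ≋-trans (·-cong (≋-refl (adj γ)) (≋-sym γ≋δ)) (≋-reflexive (adj-inverseˡ γ detγ))
      Hγ⁻¹δ : H (adj γ · δ)
      Hγ⁻¹δ = Γ[N]⊆H (adj γ · δ) (IsSL2-· (adj γ) δ (IsSL2-adj γ detγ) detδ) (toInΓ _ (inj₁ γ⁻¹δ≋I))
      γ·γ⁻¹δ≡δ : γ · (adj γ · δ) ≡ δ
      γ·γ⁻¹δ≡δ = trans (sym (·-assoc γ (adj γ) δ))
                   (trans (cong (_· δ) (adj-inverseʳ γ detγ)) (·-identityˡ δ))

    Period : (ℤ → M2) → ℤ → Set
    Period f x = ∀ t → H (f (x * t))

    module _ {f : ℤ → M2} (F : OneParameter f) where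
      open OneParameter F

      period-of-member : ∀ x → H (f x) → Period f x
      period-of-member x Hfx (+ k) = multiple k
        where
        multiple : ∀ k → H (f (x * + k))
        multiple ℕ.zero = subst H (trans (homomorphic x (- x)) (cong f x-x≡x*0))
                            (·-closed Hfx (subst H (adj-f x) (adj-closed Hfx)))
          where
          x-x≡x*0 : x - x ≡ x * + 0
          x-x≡x*0 = trans (ℤ.+-inverseʳ x) (sym (ℤ.*-zeroʳ x))
        multiple (ℕ.suc k) = subst H (trans (homomorphic x (x * + k)) (cong f (sym (ℤ.*-suc x (+ k)))))
                               (·-closed Hfx (multiple k))
      period-of-member x Hfx ℤ.-[1+ k ] =
        subst H (trans (adj-f _) (cong f (ℤ.neg-distribʳ-* x (+ ℕ.suc k))))
          (adj-closed (period-of-member x Hfx (+ ℕ.suc k)))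

      period-+ : ∀ x y → Period f x → Period f y → Period f (x + y)
      period-+ x y Px Py t =
        subst H (trans (homomorphic (x * t) (y * t)) (cong f (sym (ℤ.*-distribʳ-+ t x y))))
          (·-closed (Px t) (Py t))

      period-* : ∀ x → Period f x → ∀ s → Period f (x * s)
      period-* x Px s t = subst (λ y → H (f y)) (sym (ℤ.*-assoc x s t)) (Px (s * t))

      period-∣ : ∀ x {y} → Period f x → x ∣ y → H (f y)
      period-∣ x Px (divides q refl) = subst (λ y → H (f y)) (ℤ.*-comm x q) (Px q)

      period-level : ∀ {N} → ContainsΓ N H → (∀ {t} → + N ∣ t → f t ≋ I₂ mod + N) → Period f (+ N)
      period-level {N} Γ[N]⊆H f≋I t =
        Γ[N]⊆H (f (+ N * t)) (SL2-f (+ N * t)) (toInΓ _ (inj₁ (f≋I (∣m⇒∣m*n t ℤ∣.∣-refl))))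

open Congruences

module Comaximality where
  open import Data.Integer as ℤ using (ℤ; +_; -_; _+_; _*_; _-_; ∣_∣; _^_)
  import Data.Integer.Properties as ℤ
  open import Data.Integer.Divisibility.Signed as ℤ∣
    using (_∣_; divides; ∣ᵤ⇒∣; m∣∣m∣; ∣m∣∣m; ∣m⇒∣-m; ∣n⇒∣m*n)
  open import Data.Integer.Tactic.RingSolver using (solve)
  open import Data.List using ([]; _∷_)
  open import Data.Nat as ℕ using (ℕ; zero; suc; _<_)
  import Data.Nat.Properties as ℕ
  open import Data.Nat.Coprimality using (Coprime; coprime-Bézout; gcd≡1⇒coprime)
  import Data.Nat.Divisibility as ℕ
  open import Data.Nat.GCD using (gcd; gcd[m,n]∣m; gcd[m,n]∣n; gcd[m,n]≢0; module Bézout)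
  open import Data.Nat.Induction using (<-rec)
  import Data.Nat.Tactic.RingSolver as ℕ-Solver
  open import Data.Product using (∃; ∃₂; _,_)
  open import Data.Sum using (inj₁)
  open import Relation.Binary.PropositionalEquality
  open import Relation.Nullary using (yes; no)

  record Comaximal (x y : ℤ) : Set where
    constructor bézout
    field
      u v : ℤ
      identity : u * x + v * y ≡ + 1

  comaximal-sym : ∀ {x y} → Comaximal x y → Comaximal y x
  comaximal-sym {x} {y} (bézout u v eq) = bézout v u (trans (ℤ.+-comm (v * y) (u * x)) eq)

  comaximal-*ˡ : ∀ {x y z} → Comaximal x z → Comaximal y z → Comaximal (x * y) z
  comaximal-*ˡ {x} {y} {z} (bézout u v eq) (bézout u′ v′ eq′) =
    bézout (u * u′) (u * x * v′ + v * (u′ * y + v′ * z)) (begin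
      u * u′ * (x * y) + (u * x * v′ + v * (u′ * y + v′ * z)) * z
        ≡⟨ solve (x ∷ y ∷ z ∷ u ∷ v ∷ u′ ∷ v′ ∷ []) ⟩
      (u * x + v * z) * (u′ * y + v′ * z)
        ≡⟨ cong₂ _*_ eq eq′ ⟩
      + 1 ∎)
    where open ≡-Reasoning

  comaximal-*ʳ : ∀ {x y z} → Comaximal x y → Comaximal x z → Comaximal x (y * z)
  comaximal-*ʳ x⊥y x⊥z = comaximal-sym (comaximal-*ˡ (comaximal-sym x⊥y) (comaximal-sym x⊥z))

  comaximal-^ʳ : ∀ {x y} → Comaximal x y → ∀ k → Comaximal x (y ^ k)
  comaximal-^ʳ x⊥y zero = bézout (+ 0) (+ 1) refl
  comaximal-^ʳ x⊥y (suc k) = comaximal-*ʳ x⊥y (comaximal-^ʳ x⊥y k)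

  comaximal-∣ʳ : ∀ {x y z} → z ∣ y → Comaximal x y → Comaximal x z
  comaximal-∣ʳ {x} {z = z} (divides q refl) (bézout u v eq) =
    bézout u (v * q) (trans (cong (λ t → u * x + t) (ℤ.*-assoc v q z)) eq)

  comaximal-resp-≈ : ∀ {x x′ y} → x ≈ x′ mod y → Comaximal x′ y → Comaximal x y
  comaximal-resp-≈ {x} {x′} {y} (∣-difference (divides q x-x′≡qy)) (bézout u v eq) =
    bézout u (v - u * q) (begin
      u * x + (v - u * q) * y     ≡⟨ solve (x ∷ y ∷ u ∷ v ∷ q ∷ []) ⟩
      u * (x - q * y) + v * y     ≡⟨ cong (λ t → u * (x - t) + v * y) x-x′≡qy ⟨
      u * (x - (x - x′)) + v * y  ≡⟨ cong (λ t → u * t + v * y) (solve (x ∷ x′ ∷ [])) ⟩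
      u * x′ + v * y              ≡⟨ eq ⟩
      + 1                         ∎)
    where open ≡-Reasoning

  ≈1⇒comaximal : ∀ {x k} → x ≈ + 1 mod k → Comaximal x k
  ≈1⇒comaximal {x} {k} (∣-difference (divides q x-1≡qk)) = bézout (+ 1) (- q) (begin
    + 1 * x + - q * k  ≡⟨ solve (x ∷ q ∷ k ∷ []) ⟩
    x - q * k          ≡⟨ cong (λ t → x - t) x-1≡qk ⟨
    x - (x - + 1)      ≡⟨ solve (x ∷ []) ⟩
    + 1                ∎)
    where open ≡-Reasoning

  det⇒comaximal : ∀ {a b c d} → a * d - b * c ≡ + 1 → Comaximal a c
  det⇒comaximal {a} {b} {c} {d} det≡1 = bézout d (- b) (begin
    d * a + - b * c   ≡⟨ solve (a ∷ b ∷ c ∷ d ∷ []) ⟩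
    a * d - b * c     ≡⟨ det≡1 ⟩
    + 1               ∎)
    where open ≡-Reasoning

  comaximal⇒invertible : ∀ {x m} → Comaximal x m → ∃ λ u → x * u ≈ + 1 mod m
  comaximal⇒invertible {x} {m} (bézout u v eq) = u , ≈mod-by (∣m⇒∣-m (∣n⇒∣m*n v ℤ∣.∣-refl)) (begin
    - (v * m)                  ≡⟨ solve (x ∷ m ∷ u ∷ v ∷ []) ⟩
    x * u - (u * x + v * m)    ≡⟨ cong (λ t → x * u - t) eq ⟩
    x * u - + 1                ∎)
    where open ≡-Reasoning

  private
    pos-linear : ∀ d y n x m → d ℕ.+ y ℕ.* n ≡ x ℕ.* m → + d + + y * + n ≡ + x * + m
    pos-linear d y n x m eq = begin
      + d + + y * + n    ≡⟨ cong (λ t → + d + t) (ℤ.pos-* y n) ⟨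
      + (d ℕ.+ y ℕ.* n)  ≡⟨ cong +_ eq ⟩
      + (x ℕ.* m)        ≡⟨ ℤ.pos-* x m ⟩
      + x * + m          ∎
      where open ≡-Reasoning

    solve-for : ∀ D X Y M N → D + Y * N ≡ X * M → X * M + (- Y) * N ≡ D
    solve-for D X Y M N eq = begin
      X * M + - Y * N      ≡⟨ cong (λ t → t + - Y * N) eq ⟨
      D + Y * N + - Y * N  ≡⟨ solve (D ∷ Y ∷ N ∷ []) ⟩
      D                    ∎
      where open ≡-Reasoning

  bézout-ℤ : ∀ {d m n} → Bézout.Identity d m n → ∃₂ λ α β → α * + m + β * + n ≡ + d
  bézout-ℤ {d} {m} {n} (Bézout.+- x y d+yn≡xm) =
    + x , - + y , solve-for (+ d) (+ x) (+ y) (+ m) (+ n) (pos-linear d y n x m d+yn≡xm)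
  bézout-ℤ {d} {m} {n} (Bézout.-+ x y d+xm≡yn) =
    - + x , + y , trans (ℤ.+-comm (- + x * + m) (+ y * + n))
                        (solve-for (+ d) (+ y) (+ x) (+ n) (+ m) (pos-linear d x m y n d+xm≡yn))

  coprime⇒comaximal : ∀ {m n} → Coprime m n → Comaximal (+ m) (+ n)
  coprime⇒comaximal m⊥n with bézout-ℤ (coprime-Bézout m⊥n)
  ... | α , β , eq = bézout α β eq

  record CoprimeSplitting (m N : ℕ) : Set where
    field
      coprimePart powerPart exponent : ℕ
      N≡product : N ≡ coprimePart ℕ.* powerPart
      coprime : Coprime coprimePart m
      powerPart∣m^k : powerPart ℕ.∣ m ℕ.^ exponent

  -- Split off gcd(N, m) repeatedly until what is left is coprime to m.
  coprimeSplitting : ∀ m N → 0 < N → CoprimeSplitting m N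
  coprimeSplitting m = <-rec (λ N → 0 < N → CoprimeSplitting m N) split
    where
    split : ∀ N → (∀ {M} → M < N → 0 < M → CoprimeSplitting m M) → 0 < N → CoprimeSplitting m N
    split N rec 0<N with gcd N m ℕ.≟ 1 | gcd[m,n]∣m N m
    ... | yes g≡1 | _ = record
      { coprimePart = N ; powerPart = 1 ; exponent = 0
      ; N≡product = sym (ℕ.*-identityʳ N) ; coprime = gcd≡1⇒coprime g≡1 ; powerPart∣m^k = ℕ.∣-refl }
    ... | no g≢1 | ℕ.divides q N≡qg = record
      { coprimePart = coprimePart ; powerPart = g ℕ.* powerPart ; exponent = suc exponent
      ; N≡product = trans N≡qg (trans (cong (ℕ._* g) N≡product) (regroup coprimePart powerPart g))
      ; coprime = coprime
      ; powerPart∣m^k = ℕ.*-pres-∣ (gcd[m,n]∣n N m) powerPart∣m^k }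
      where
      g = gcd N m
      q≢0 : q ≢ 0
      q≢0 refl = ℕ.<-irrefl (sym N≡qg) 0<N
      1<g : 1 < g
      1<g = ℕ.≤∧≢⇒< (ℕ.n≢0⇒n>0 (gcd[m,n]≢0 N m (inj₁ λ N≡0 → ℕ.<-irrefl (sym N≡0) 0<N)))
                    (λ 1≡g → g≢1 (sym 1≡g))
      q<N : q < N
      q<N = subst (q <_) (sym N≡qg) (ℕ.m<m*n q g {{ℕ.≢-nonZero q≢0}} 1<g)
      open CoprimeSplitting (rec q<N (ℕ.n≢0⇒n>0 q≢0))
      regroup : ∀ r s g → r ℕ.* s ℕ.* g ≡ r ℕ.* (g ℕ.* s)
      regroup = ℕ-Solver.solve-∀

  pos-^ : ∀ m k → + (m ℕ.^ k) ≡ (+ m) ^ k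
  pos-^ m zero = refl
  pos-^ m (suc k) = trans (ℤ.pos-* m (m ℕ.^ k)) (cong (+ m *_) (pos-^ m k))

  -- r is the part of N coprime to a; modulo r the shift a + r b is a, and modulo
  -- the rest of N (whose primes all divide a) it is r b.
  comaximal-shift : ∀ {a b} N → 0 < N → Comaximal a b → ∃ λ r → Comaximal (a + + r * b) (+ N)
  comaximal-shift {a} {b} N 0<N a⊥b =
    r , subst (Comaximal (a + + r * b)) +N≡r*s (comaximal-*ʳ modulo-r modulo-s)
    where
    open CoprimeSplitting (coprimeSplitting ∣ a ∣ N 0<N)
      renaming (coprimePart to r; powerPart to s; exponent to k)
    r⊥a : Comaximal (+ r) a
    r⊥a = comaximal-∣ʳ m∣∣m∣ (coprime⇒comaximal coprime)
    modulo-r : Comaximal (a + + r * b) (+ r)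
    modulo-r = comaximal-resp-≈ (x+y*t≈x a (+ r) b) (comaximal-sym r⊥a)
    rb⊥a : Comaximal (+ r * b) a
    rb⊥a = comaximal-*ˡ r⊥a (comaximal-sym a⊥b)
    modulo-s : Comaximal (a + + r * b) (+ s)
    modulo-s = comaximal-∣ʳ (subst (+ s ∣_) (pos-^ ∣ a ∣ k) (∣ᵤ⇒∣ powerPart∣m^k))
                 (comaximal-^ʳ (comaximal-∣ʳ ∣m∣∣m (comaximal-resp-≈ (y+x≈x (+ r * b) a) rb⊥a)) k)
    +N≡r*s : + r * + s ≡ + N
    +N≡r*s = trans (sym (ℤ.pos-* r s)) (cong +_ (sym N≡product))

open Comaximality

module Generation where
  open import Data.Integer as ℤ using (ℤ; +_; -_; _+_; _*_; _-_)
  import Data.Integer.Properties as ℤ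
  open import Data.Integer.Divisibility.Signed as ℤ∣
    using (_∣_; divides; ∣m∣n⇒∣m-n; ∣m⇒∣-m; ∣n⇒∣m*n; ∣m⇒∣m*n)
  open import Data.Integer.Tactic.RingSolver using (solve; solve-∀)
  open import Data.List using ([]; _∷_)
  open import Data.Nat as ℕ using (ℕ; _<_)
  open import Data.Nat.GCD using (gcd; gcd-GCD; module Bézout)
  open import Data.Product using (∃₂; proj₁; proj₂)
  open import Data.Sum using (inj₁; inj₂)
  open import Relation.Binary.PropositionalEquality

  torus : ℤ → ℤ → ℤ → M2
  torus x v u = lo (- (v * u)) · ((up x · lo v) · up (- (x * u)))

  -- torus x v u differs from diag (1 + x v) u by ((1 + x v) u - 1) · [[0, -x], [-v, x u v - 1]].
  torus-≋-diag : ∀ {m} x v u → (+ 1 + x * v) * u ≈ + 1 mod m → torus x v u ≋ diag (+ 1 + x * v) u mod m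
  torus-≋-diag x v u (∣-difference m∣e) = ≋-trans (≋-reflexive torus-entries) (entrywise≡
    (≈mod-refl (+ 1 + x * v))
    (≈mod-by (∣n⇒∣m*n (- x) m∣e) (b-entry x v u))
    (≈mod-by (∣n⇒∣m*n (- v) m∣e) (c-entry x v u))
    (≈mod-by (∣n⇒∣m*n (x * u * v - + 1) m∣e) (d-entry x v u)))
    where
    b₁ = x + (+ 1 + x * v) * - (x * u)
    d₁ = + 1 + v * - (x * u)
    torus-entries : torus x v u ≡ mat (+ 1 + x * v) b₁ (v + - (v * u) * (+ 1 + x * v)) (d₁ + - (v * u) * b₁)
    torus-entries = trans (cong (lo (- (v * u)) ·_) (trans (cong (_· up (- (x * u))) (up-·-lo x v))
                                                            (·-up (mat (+ 1 + x * v) x v (+ 1)) (- (x * u)))))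
                          (lo-· (- (v * u)) (mat (+ 1 + x * v) b₁ v d₁))
    b-entry : ∀ x v u → - x * ((+ 1 + x * v) * u - + 1) ≡ x + (+ 1 + x * v) * - (x * u) - + 0
    b-entry = solve-∀
    c-entry : ∀ x v u → - v * ((+ 1 + x * v) * u - + 1) ≡ v + - (v * u) * (+ 1 + x * v) - + 0
    c-entry = solve-∀
    d-entry : ∀ x v u → (x * u * v - + 1) * ((+ 1 + x * v) * u - + 1) ≡
                        + 1 + v * - (x * u) + - (v * u) * (x + (+ 1 + x * v) * - (x * u)) - u
    d-entry = solve-∀

  diag-cong : ∀ {m x x′} y → x ≈ x′ mod m → diag x y ≋ diag x′ y mod m
  diag-cong y x≈x′ = entrywise≡ x≈x′ (≈mod-refl (+ 0)) (≈mod-refl (+ 0)) (≈mod-refl y)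

  -- The entries differ by (a u - 1) (0, b, c, d + u b c) - u (0, 0, 0, det - 1).
  lower-diag-upper-≋ : ∀ {m} γ u → IsSL2 γ → a γ * u ≈ + 1 mod m →
                       lo (c γ * u) · (diag (a γ) u · up (u * b γ)) ≋ γ mod m
  lower-diag-upper-≋ {m} (mat a b c d) u det≡1 (∣-difference m∣e) = ≋-trans (≋-reflexive entries) (entrywise≡
    (≈mod-refl a)
    (≈mod-by (∣n⇒∣m*n b m∣e) (b-entry a b u))
    (≈mod-by (∣n⇒∣m*n c m∣e) (c-entry a c u))
    (≈mod-by (∣m∣n⇒∣m-n (∣n⇒∣m*n (d + u * b * c) m∣e) m∣u[det-1]) (d-entry a b c d u)))
    where
    b₁ = + 0 + a * (u * b)
    entries : lo (c * u) · (diag a u · up (u * b)) ≡ mat a b₁ (+ 0 + c * u * a) (u + + 0 + c * u * b₁)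
    entries = trans (cong (lo (c * u) ·_) (·-up (diag a u) (u * b))) (lo-· (c * u) (mat a b₁ (+ 0) (u + + 0)))
    m∣u[det-1] : m ∣ u * (a * d - b * c - + 1)
    m∣u[det-1] = subst (λ t → m ∣ u * (t - + 1)) (sym det≡1) (∣n⇒∣m*n u (divides (+ 0) refl))
    b-entry : ∀ a b u → b * (a * u - + 1) ≡ + 0 + a * (u * b) - b
    b-entry = solve-∀
    c-entry : ∀ a c u → c * (a * u - + 1) ≡ + 0 + c * u * a - c
    c-entry = solve-∀
    d-entry : ∀ a b c d u → (d + u * b * c) * (a * u - + 1) - u * (a * d - b * c - + 1) ≡
                            u + + 0 + c * u * (+ 0 + a * (u * b)) - d
    d-entry = solve-∀

  factorisation-≋ : ∀ {m} γ x v u → IsSL2 γ → a γ * u ≈ + 1 mod m → a γ ≈ + 1 + x * v mod m →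
                    lo (c γ * u) · (torus x v u · up (u * b γ)) ≋ γ mod m
  factorisation-≋ γ x v u detγ au≈1 a≈1+xv =
    ≋-trans (·-cong (≋-refl (lo (c γ * u))) (·-cong torus≋diag (≋-refl (up (u * b γ)))))
            (lower-diag-upper-≋ γ u detγ au≈1)
    where
    [1+xv]u≈1 : (+ 1 + x * v) * u ≈ + 1 mod _
    [1+xv]u≈1 = ≈mod-trans (≈mod-* (≈mod-sym a≈1+xv) (≈mod-refl u)) au≈1
    torus≋diag : torus x v u ≋ diag (a γ) u mod _
    torus≋diag = ≋-trans (torus-≋-diag x v u [1+xv]u≈1) (diag-cong u (≈mod-sym a≈1+xv))

  up-≋-I₂ : ∀ {m t} → m ∣ t → up t ≋ I₂ mod m
  up-≋-I₂ {t = t} m∣t =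
    entrywise≡ (≈mod-refl (+ 1)) (≈mod-by m∣t (sym (ℤ.+-identityʳ t))) (≈mod-refl (+ 0)) (≈mod-refl (+ 1))

  lo-≋-I₂ : ∀ {m t} → m ∣ t → lo t ≋ I₂ mod m
  lo-≋-I₂ {t = t} m∣t =
    entrywise≡ (≈mod-refl (+ 1)) (≈mod-refl (+ 0)) (≈mod-by m∣t (sym (ℤ.+-identityʳ t))) (≈mod-refl (+ 1))

  ≈1+wv : ∀ {n k y} α β w v a′ → α * n + β * (w * v) ≡ k → y - + 1 ≡ a′ * k →
          y ≈ + 1 + w * (β * a′) * v mod n
  ≈1+wv {n} {k} {y} α β w v a′ k≡αn+βwv y-1≡a′k = ≈mod-by (∣m⇒∣m*n (α * a′) ℤ∣.∣-refl) (begin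
    n * (α * a′)                                 ≡⟨ solve (n ∷ α ∷ β ∷ w ∷ v ∷ a′ ∷ []) ⟩
    a′ * (α * n + β * (w * v)) - w * (β * a′) * v ≡⟨ cong (λ t → a′ * t - w * (β * a′) * v) k≡αn+βwv ⟩
    a′ * k - w * (β * a′) * v                     ≡⟨ cong (λ t → t - w * (β * a′) * v) (sym y-1≡a′k) ⟩
    y - + 1 - w * (β * a′) * v                    ≡⟨ solve (y ∷ w ∷ β ∷ a′ ∷ v ∷ []) ⟩
    y - (+ 1 + w * (β * a′) * v)                  ∎)
    where open ≡-Reasoning

  module _ {H : M2 → Set} (isSubgroup : IsSubgroup H) {N : ℕ} (0<N : 0 < N) (Γ[N]⊆H : ContainsΓ N H)
           (w v : ℕ) (H∋up-w : H (up (+ w))) (H∋lo-v : H (lo (+ v))) where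
    open IsSubgroup isSubgroup
    open SubgroupProperties isSubgroup

    private
      K : ℕ
      K = gcd N (w ℕ.* v)

      bézout-K : ∃₂ λ α β → α * + N + β * + (w ℕ.* v) ≡ + K
      bézout-K = bézout-ℤ (Bézout.identity (gcd-GCD N (w ℕ.* v)))
      α = proj₁ bézout-K
      β = proj₁ (proj₂ bézout-K)
      K≡αN+βwv : α * + N + β * (+ w * + v) ≡ + K
      K≡αN+βwv = trans (cong (λ t → α * + N + β * t) (sym (ℤ.pos-* w v))) (proj₂ (proj₂ bézout-K))

      period-K : ∀ {f} (F : OneParameter f) x y → x * y ≡ + w * + v →
                 Period f x → Period f (+ N) → Period f (+ K)
      period-K {f} F x y xy≡wv Px PN = subst (Period f) K-combination
        (period-+ F (x * (y * β)) (+ N * α) (period-* F x Px (y * β)) (period-* F (+ N) PN α))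
        where
        regroup : ∀ x y β n α → x * (y * β) + n * α ≡ α * n + β * (x * y)
        regroup x y β n α = solve (x ∷ y ∷ β ∷ n ∷ α ∷ [])
        K-combination : x * (y * β) + + N * α ≡ + K
        K-combination = trans (regroup x y β (+ N) α) (trans (cong (λ t → α * + N + β * t) xy≡wv) K≡αN+βwv)

      up-period-w : Period up (+ w)
      up-period-w = period-of-member up-oneParameter (+ w) H∋up-w

      lo-period-v : Period lo (+ v)
      lo-period-v = period-of-member lo-oneParameter (+ v) H∋lo-v

      up-period-K : Period up (+ K)
      up-period-K = period-K up-oneParameter (+ w) (+ v) refl up-period-w
                      (period-level up-oneParameter Γ[N]⊆H up-≋-I₂)

      lo-period-K : Period lo (+ K)
      lo-period-K = period-K lo-oneParameter (+ v) (+ w) (ℤ.*-comm (+ v) (+ w)) lo-period-v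
                      (period-level lo-oneParameter Γ[N]⊆H lo-≋-I₂)

      H∋torus : ∀ β′ u → H (torus (+ w * β′) (+ v) u)
      H∋torus β′ u = ·-closed H∋lo[-vu] (·-closed (·-closed H∋up-x H∋lo-v) H∋up[-xu])
        where
        H∋lo[-vu] = period-∣ lo-oneParameter (+ v) lo-period-v (∣m⇒∣-m (∣m⇒∣m*n u ℤ∣.∣-refl))
        H∋up-x = period-∣ up-oneParameter (+ w) up-period-w (∣m⇒∣m*n β′ ℤ∣.∣-refl)
        H∋up[-xu] = period-∣ up-oneParameter (+ w) up-period-w
                      (∣m⇒∣-m (∣m⇒∣m*n u (∣m⇒∣m*n β′ ℤ∣.∣-refl)))

      corner-unit⇒H : ∀ η u → IsSL2 η → η ≋ I₂ mod + K → a η * u ≈ + 1 mod + N → H η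
      corner-unit⇒H η u detη (entrywise≡ (∣-difference (divides a′ a-1≡a′K)) K∣b K∣c _) au≈1 =
        ≋-closed Γ[N]⊆H detη
          (factorisation-≋ η (+ w * (β * a′)) (+ v) u detη au≈1
            (≈1+wv α β (+ w) (+ v) a′ K≡αN+βwv a-1≡a′K))
          (·-closed H∋lo[cu] (·-closed (H∋torus (β * a′) u) H∋up[ub]))
        where
        H∋lo[cu] = period-∣ lo-oneParameter (+ K) lo-period-K (∣m⇒∣m*n u (≈0⇒∣ K∣c))
        H∋up[ub] = period-∣ up-oneParameter (+ K) up-period-K (∣n⇒∣m*n u (≈0⇒∣ K∣b))

      ≋I₂⇒H : ∀ γ → IsSL2 γ → γ ≋ I₂ mod + K → H γ
      ≋I₂⇒H γ@(mat a b c d) detγ γ≋I@(entrywise≡ a≈1 _ _ _) =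
        subst H (up-cancel (+ K * + r) γ) (·-closed H∋up[-Kr] (corner-unit⇒H η u detη η≋I au≈1))
        where
        shift = comaximal-shift N 0<N (comaximal-*ʳ (≈1⇒comaximal a≈1) (det⇒comaximal {a} {b} {c} {d} detγ))
        r = proj₁ shift
        η = up (+ K * + r) · γ
        detη : IsSL2 η
        detη = IsSL2-· (up (+ K * + r)) γ (OneParameter.SL2-f up-oneParameter (+ K * + r)) detγ
        η≋I : η ≋ I₂ mod + K
        η≋I = ·-cong (up-≋-I₂ (∣m⇒∣m*n (+ r) ℤ∣.∣-refl)) γ≋I
        corner : ∀ a c k r → a + r * (k * c) ≡ + 1 * a + k * r * c
        corner a c k r = solve (a ∷ c ∷ k ∷ r ∷ [])
        invertible = comaximal⇒invertible (subst (λ x → Comaximal x (+ N)) (corner a c (+ K) (+ r)) (proj₂ shift))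
        u = proj₁ invertible
        au≈1 = proj₂ invertible
        H∋up[-Kr] = period-∣ up-oneParameter (+ K) up-period-K (∣m⇒∣-m (∣m⇒∣m*n (+ r) ℤ∣.∣-refl))

    containsΓ-gcd : ContainsΓ (gcd N (w ℕ.* v)) H
    containsΓ-gcd γ detγ γ∈Γ[K] with fromInΓ γ γ∈Γ[K]
    ... | inj₁ γ≋I = ≋I₂⇒H γ detγ γ≋I
    ... | inj₂ γ≋-I =
      subst H (neg-involutive γ) (neg-closed (≋I₂⇒H (neg γ) (IsSL2-neg γ detγ) (neg-cong γ≋-I)))

open Generation

module Stabilisers where
  open import Data.Fin.Permutation using (inverseˡ; inverseʳ)
  open import Data.Integer as ℤ using (ℤ; +_; -_; _*_)
  import Data.Integer.Properties as ℤ
  open import Data.List using ([]; _∷_; _++_)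
  open import Data.Nat using (ℕ; zero; suc)
  open import Data.Product using (∃; _×_; _,_)
  open import Data.Sum using (inj₁; inj₂)
  open import Relation.Binary.PropositionalEquality

  ≈±-· : ∀ {X Y γ δ} → X ≈± γ → Y ≈± δ → (X · Y) ≈± (γ · δ)
  ≈±-· (inj₁ refl) (inj₁ refl) = inj₁ refl
  ≈±-· {γ = γ} {δ} (inj₁ refl) (inj₂ refl) = inj₂ (neg-distribʳ-· γ δ)
  ≈±-· {γ = γ} {δ} (inj₂ refl) (inj₁ refl) = inj₂ (neg-distribˡ-· γ δ)
  ≈±-· {γ = γ} {δ} (inj₂ refl) (inj₂ refl) =
    inj₁ (trans (neg-distribˡ-· γ (neg δ)) (trans (cong neg (neg-distribʳ-· γ δ)) (neg-involutive (γ · δ))))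

  letterInverse : Letter → Letter
  letterInverse A = A⁻¹
  letterInverse A⁻¹ = A
  letterInverse B = B⁻¹
  letterInverse B⁻¹ = B

  wordInverse : Word → Word
  wordInverse [] = []
  wordInverse (l ∷ w) = wordInverse w ++ (letterInverse l ∷ [])

  wordMat-++ : ∀ u w → wordMat (u ++ w) ≡ wordMat u · wordMat w
  wordMat-++ [] w = sym (·-identityˡ (wordMat w))
  wordMat-++ (l ∷ u) w =
    trans (cong (letterMat l ·_) (wordMat-++ u w)) (sym (·-assoc (letterMat l) (wordMat u) (wordMat w)))

  letterMat-inverse : ∀ l → letterMat (letterInverse l) ≡ adj (letterMat l)
  letterMat-inverse A = refl
  letterMat-inverse A⁻¹ = refl
  letterMat-inverse B = refl
  letterMat-inverse B⁻¹ = refl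

  wordMat-inverse : ∀ w → wordMat (wordInverse w) ≡ adj (wordMat w)
  wordMat-inverse [] = refl
  wordMat-inverse (l ∷ w) = begin
    wordMat (wordInverse w ++ (letterInverse l ∷ []))        ≡⟨ wordMat-++ (wordInverse w) _ ⟩
    wordMat (wordInverse w) · (letterMat (letterInverse l) · I₂)
      ≡⟨ cong₂ _·_ (wordMat-inverse w) (trans (·-identityʳ _) (letterMat-inverse l)) ⟩
    adj (wordMat w) · adj (letterMat l)                      ≡⟨ adj-anti-· (letterMat l) (wordMat w) ⟨
    adj (letterMat l · wordMat w)                            ∎
    where open ≡-Reasoning

  IsSL2-wordMat : ∀ w → IsSL2 (wordMat w)
  IsSL2-wordMat [] = refl
  IsSL2-wordMat (l ∷ w) = IsSL2-· (letterMat l) (wordMat w) (IsSL2-letter l) (IsSL2-wordMat w)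
    where
    IsSL2-letter : ∀ l → IsSL2 (letterMat l)
    IsSL2-letter A = refl
    IsSL2-letter A⁻¹ = refl
    IsSL2-letter B = refl
    IsSL2-letter B⁻¹ = refl

  power : Word → ℕ → Word
  power w zero = []
  power w (suc k) = power w k ++ w

  module _ (Γ : CosetAction) where

    act-++ : ∀ u w x → act Γ (u ++ w) x ≡ act Γ w (act Γ u x)
    act-++ [] w x = refl
    act-++ (l ∷ u) w x = act-++ u w (actLetter Γ l x)

    act-inverse : ∀ w x → act Γ (wordInverse w) (act Γ w x) ≡ x
    act-inverse [] x = refl
    act-inverse (l ∷ w) x =
      trans (act-++ (wordInverse w) (letterInverse l ∷ []) _)
        (trans (cong (actLetter Γ (letterInverse l)) (act-inverse w _)) (letter-inverse l))
      where
      letter-inverse : ∀ l → actLetter Γ (letterInverse l) (actLetter Γ l x) ≡ x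
      letter-inverse A = inverseˡ (pA Γ)
      letter-inverse A⁻¹ = inverseʳ (pA Γ)
      letter-inverse B = inverseˡ (pB Γ)
      letter-inverse B⁻¹ = inverseʳ (pB Γ)

    Stab : Pt Γ → M2 → Set
    Stab y γ = ∃ λ w → (wordMat w ≈± γ) × (act Γ w y ≡ y)

    stab-isSubgroup : ∀ y → IsSubgroup (Stab y)
    stab-isSubgroup y = record
      { ⊆SL2 = λ { (w , inj₁ refl , _) → IsSL2-wordMat w
                 ; {X} (w , inj₂ w≡-X , _) → trans (sym (det-neg X)) (subst IsSL2 w≡-X (IsSL2-wordMat w)) }
      ; ·-closed = λ { {X} {Y} (u , u≈X , uy≡y) (w , w≈Y , wy≡y) →
          u ++ w , subst (_≈± (X · Y)) (sym (wordMat-++ u w)) (≈±-· u≈X w≈Y) ,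
          trans (act-++ u w y) (trans (cong (act Γ w) uy≡y) wy≡y) }
      ; adj-closed = λ { {X} (w , w≈X , wy≡y) →
          wordInverse w , subst (_≈± adj X) (sym (wordMat-inverse w)) (≈±-adj w≈X) ,
          trans (cong (act Γ (wordInverse w)) (sym wy≡y)) (act-inverse w y) }
      ; neg-closed = λ { {X} (w , w≈X , wy≡y) → w , ≈±-neg w≈X , wy≡y }
      }
      where
      ≈±-adj : ∀ {X γ} → X ≈± γ → adj X ≈± adj γ
      ≈±-adj (inj₁ refl) = inj₁ refl
      ≈±-adj {γ = γ} (inj₂ refl) = inj₂ (adj-neg γ)
      ≈±-neg : ∀ {X γ} → X ≈± γ → X ≈± neg γ
      ≈±-neg {γ = γ} (inj₁ X≡γ) = inj₂ (trans X≡γ (sym (neg-involutive γ)))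
      ≈±-neg (inj₂ X≡-γ) = inj₁ X≡-γ

    stab-conj : ∀ g {y y′ γ} → act Γ g y ≡ y′ → Stab y γ → Stab y′ (conj (wordMat g) γ)
    stab-conj g {y} {y′} {γ} gy≡y′ (w , w≈γ , wy≡y) =
      wordInverse g ++ (w ++ g) , subst (_≈± conj G γ) (sym word-matrix) matrix-≈± , (begin
        act Γ (wordInverse g ++ (w ++ g)) y′       ≡⟨ act-++ (wordInverse g) (w ++ g) y′ ⟩
        act Γ (w ++ g) (act Γ (wordInverse g) y′)
          ≡⟨ cong (λ z → act Γ (w ++ g) (act Γ (wordInverse g) z)) gy≡y′ ⟨
        act Γ (w ++ g) (act Γ (wordInverse g) (act Γ g y))
          ≡⟨ cong (act Γ (w ++ g)) (act-inverse g y) ⟩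
        act Γ (w ++ g) y                           ≡⟨ act-++ w g y ⟩
        act Γ g (act Γ w y)                        ≡⟨ cong (act Γ g) wy≡y ⟩
        act Γ g y                                  ≡⟨ gy≡y′ ⟩
        y′                                         ∎)
      where
      open ≡-Reasoning
      G = wordMat g
      word-matrix : wordMat (wordInverse g ++ (w ++ g)) ≡ adj G · (wordMat w · G)
      word-matrix = trans (wordMat-++ (wordInverse g) (w ++ g)) (cong₂ _·_ (wordMat-inverse g) (wordMat-++ w g))
      matrix-≈± : (adj G · (wordMat w · G)) ≈± conj G γ
      matrix-≈± = subst ((adj G · (wordMat w · G)) ≈±_) (sym (·-assoc (adj G) γ G))
                    (≈±-· {adj G} {wordMat w · G} {adj G} {γ · G} (inj₁ refl)
                          (≈±-· {wordMat w} {G} {γ} {G} w≈γ (inj₁ refl)))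

    containsΓ-transport : ∀ {m} g {y y′} → act Γ g y ≡ y′ → ContainsΓ m (Stab y) → ContainsΓ m (Stab y′)
    containsΓ-transport g gy≡y′ Γ[m]⊆Stab-y =
      containsΓ-unconj (wordMat g) (IsSL2-wordMat g)
        (λ γ detγ γ∈Γ[m] → stab-conj g gy≡y′ (Γ[m]⊆Stab-y γ detγ γ∈Γ[m]))

    containsΓ-transport⁻¹ : ∀ {m} g {y y′} → act Γ g y ≡ y′ → ContainsΓ m (Stab y′) → ContainsΓ m (Stab y)
    containsΓ-transport⁻¹ g {y} gy≡y′ = containsΓ-transport (wordInverse g)
      (trans (cong (act Γ (wordInverse g)) (sym gy≡y′)) (act-inverse g y))

    act-power : ∀ w k y → act Γ (power w k) y ≡ iter (act Γ w) k y
    act-power w zero y = refl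
    act-power w (suc k) y = trans (act-++ (power w k) w y) (cong (act Γ w) (act-power w k y))

  wordMat-power : ∀ {f} → OneParameter f → ∀ {w t} → wordMat w ≈± f t → ∀ k → wordMat (power w k) ≈± f (+ k * t)
  wordMat-power F w≈ft zero = inj₁ (sym (OneParameter.at-zero F))
  wordMat-power {f} F {w} {t} w≈ft (suc k) =
    subst (wordMat (power w (suc k)) ≈±_) f[kt]·f[t]≡f[[1+k]t]
      (subst (_≈± (f (+ k * t) · f t)) (sym (wordMat-++ (power w k) w))
        (≈±-· {wordMat (power w k)} {wordMat w} {f (+ k * t)} {f t} (wordMat-power F w≈ft k) w≈ft))
    where
    f[kt]·f[t]≡f[[1+k]t] : f (+ k * t) · f t ≡ f (+ suc k * t)
    f[kt]·f[t]≡f[[1+k]t] = trans (OneParameter.homomorphic F (+ k * t) t)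
                             (cong f (trans (ℤ.+-comm (+ k * t) t) (sym (ℤ.suc-* (+ k) t))))

  iter-comm : ∀ {X : Set} (σ : X → X) k y → iter σ k (σ y) ≡ σ (iter σ k y)
  iter-comm σ zero y = refl
  iter-comm σ (suc k) y = cong σ (iter-comm σ k y)

  iter-fixed-on-cycle : ∀ {X : Set} (σ : X → X) {k y x} → CycleLength σ y k → InCycle σ y x → iter σ k x ≡ x
  iter-fixed-on-cycle σ {k} {y} (_ , σᵏy≡y , _) (j , refl) = fixed j
    where
    fixed : ∀ j → iter σ k (iter σ j y) ≡ iter σ j y
    fixed zero = σᵏy≡y
    fixed (suc j) = trans (iter-comm σ k (iter σ j y)) (cong σ (fixed j))

  face-stab : ∀ Γ {f d x} → CycleLength (σA Γ) f d → InCycle (σA Γ) f x → Stab Γ x (up (+ d * + 2))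
  face-stab Γ {d = d} {x} cycle x∈F =
    power (A ∷ []) d , wordMat-power up-oneParameter (inj₁ refl) d ,
    trans (act-power Γ (A ∷ []) d x) (iter-fixed-on-cycle (σA Γ) cycle x∈F)

  vertexWord : Colour → Word
  vertexWord black = B ∷ []
  vertexWord white = A ∷ B⁻¹ ∷ []

  -- The white vertex word A B⁻¹ is - up(1) lo(2) up(-1), parabolic with fixed point 1.
  vertexShift : Colour → ℤ
  vertexShift black = + 0
  vertexShift white = - + 1

  vertexWord-≈± : ∀ col → wordMat (vertexWord col) ≈± conj (up (vertexShift col)) (lo (+ 2))
  vertexWord-≈± black = inj₁ refl
  vertexWord-≈± white = inj₂ refl

  vertex-stab : ∀ Γ col {u e x} → CycleLength (vertexPerm Γ col) u e → InCycle (vertexPerm Γ col) u x →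
                Stab Γ x (conj (up (vertexShift col)) (lo (+ e * + 2)))
  vertex-stab Γ col {e = e} {x} cycle x∈v =
    power (vertexWord col) e ,
    wordMat-power (conj-oneParameter P (OneParameter.SL2-f up-oneParameter (vertexShift col)) lo-oneParameter)
                  {t = + 2} (vertexWord-≈± col) e ,
    trans (act-power Γ (vertexWord col) e x)
          (trans (iter-vertexPerm col) (iter-fixed-on-cycle (vertexPerm Γ col) cycle x∈v))
    where
    P = up (vertexShift col)
    iter-vertexPerm : ∀ col → iter (act Γ (vertexWord col)) e x ≡ iter (vertexPerm Γ col) e x
    iter-vertexPerm black = refl
    iter-vertexPerm white = refl

open Stabilisers

open import Data.Empty using (⊥-elim)
open import Data.Integer using (+_)
import Data.Integer.Properties as ℤ
open import Data.List using ([]; _∷_)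
open import Data.Nat using (ℕ; _*_; _<_; >-nonZero)
import Data.Nat.Properties as ℕ
open import Data.Nat.Divisibility using (_∣_; ∣⇒≤; *-cancelˡ-∣)
open import Data.Nat.GCD using (gcd; gcd[m,n]∣m; gcd[m,n]∣n; gcd[m,n]≢0)
open import Data.Nat.Tactic.RingSolver using (solve)
open import Data.Product using (_,_; proj₁; proj₂)
open import Data.Sum using (inj₁)
open import Relation.Binary.PropositionalEquality
open import Relation.Nullary using (¬_; yes; no)

least-divides : ∀ (P : ℕ → Set) {N m} → 0 < N → (∀ k → 0 < k → k < N → ¬ P k) → P (gcd N m) → N ∣ m
least-divides P {N} {m} 0<N minimal P[gcd] with gcd N m ℕ.<? N
... | yes gcd<N = ⊥-elim (minimal (gcd N m) (ℕ.n≢0⇒n>0 (gcd[m,n]≢0 N m (inj₁ N≢0))) gcd<N P[gcd])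
  where
  N≢0 : N ≢ 0
  N≢0 N≡0 = ℕ.<-irrefl (sym N≡0) 0<N
... | no gcd≮N = subst (_∣ m) gcd≡N (gcd[m,n]∣n N m)
  where
  gcd≡N : gcd N m ≡ N
  gcd≡N = ℕ.≤-antisym (∣⇒≤ {{>-nonZero 0<N}} (gcd[m,n]∣m N m)) (ℕ.≮⇒≥ gcd≮N)

mainTheorem1 : (Γ : CosetAction) → Transitive Γ →
    (n : ℕ) → HasLevel Γ (2 * n) →
    -- face F = A-cycle through f, of degree d
    (f : Pt Γ) (d : ℕ) → CycleLength (σA Γ) f d →
    -- vertex v = cycle through u of colour col, of degree e
    (col : Colour) (u : Pt Γ) (e : ℕ) → CycleLength (vertexPerm Γ col) u e →
    -- v lies on the boundary of F: some edge of F is incident to v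
    (x : Pt Γ) → InCycle (σA Γ) f x → InCycle (vertexPerm Γ col) u x →
    n ∣ 2 * d * e
mainTheorem1 Γ transitive n (0<2n , Γ[2n]⊆Γ , minimal) f d face col u e vertex x x∈F x∈v =
  *-cancelˡ-∣ 2 (subst (2 * n ∣_) [2d][2e]≡2[2de] 2n∣[2d][2e])
  where
  [2d][2e]≡2[2de] : d * 2 * (e * 2) ≡ 2 * (2 * d * e)
  [2d][2e]≡2[2de] = solve (d ∷ e ∷ [])
  P = up (vertexShift col)
  detP = OneParameter.SL2-f up-oneParameter (vertexShift col)
  H : M2 → Set
  H X = Stab Γ x (conj P X)
  g = proj₁ (transitive (base Γ) x)
  g·base≡x = proj₂ (transitive (base Γ) x)
  H∋up : H (up (+ (d * 2)))
  H∋up = subst (Stab Γ x) (sym (conj-up-up (vertexShift col) _))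
           (subst (λ t → Stab Γ x (up t)) (sym (ℤ.pos-* d 2)) (face-stab Γ face x∈F))
  H∋lo : H (lo (+ (e * 2)))
  H∋lo = subst (λ t → H (lo t)) (sym (ℤ.pos-* e 2)) (vertex-stab Γ col vertex x∈v)
  Γ[2n]⊆H : ContainsΓ (2 * n) H
  Γ[2n]⊆H = containsΓ-conj P detP (containsΓ-transport Γ g g·base≡x Γ[2n]⊆Γ)
  Γ[K]⊆H : ContainsΓ (gcd (2 * n) (d * 2 * (e * 2))) H
  Γ[K]⊆H = containsΓ-gcd (conjugate-isSubgroup P detP (stab-isSubgroup Γ x)) 0<2n Γ[2n]⊆H (d * 2) (e * 2) H∋up H∋lo
  2n∣[2d][2e] : 2 * n ∣ d * 2 * (e * 2)
  2n∣[2d][2e] = least-divides (Γ[_]⊆ Γ) 0<2n minimal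
                  (containsΓ-transport⁻¹ Γ g g·base≡x (containsΓ-unconj P detP Γ[K]⊆H))
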